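{- Let $v\in\{a,b\}^+$ and $w=a\psi(v)b$. Then $|\partial w|=\pi(\psi(\tilde v))=|a\psi(v)b|_{y}$, where $y$ is the letter different from the first letter of $v$.
   Context: Alphabet $\{a,b\}$. $\tilde v$ is the reversal of $v$; $|u|_y$ is the number of occurrences of the letter $y$ in $u$; $\pi(u)$ is the minimal period of $u$ (the least $p\ge1$ with $u_i=u_{i+p}$ whenever both defined), with $\pi(\varepsilon)=1$. Palindromization map: $\psi(\varepsilon)=\varepsilon$, $\psi(ux)=(\psi(u)x)^{(+)}$, where $z^{(+)}$ is the shortest palindrome with prefix $z$. Write $v=x_0^{\alpha_0}\cdots x_n^{\alpha_n}$ uniquely with $\alpha_i\ge1$, $x_{i+1}\ne x_i$; the index of $a\psi(v)b$ is $\alpha_0$ (and $0$ for $v=\varepsilon$). With $\varphi_k:a\mapsto a^{k+1}b,\ b\mapsto a^kb$ and $\hat\varphi_k:a\mapsto ab^k,\ b\mapsto ab^{k+1}$, the derivative of a proper Christoffel word $w=a\psi(v)b$ of index $k$ is $\partial ab=a$ if $k=0$, $\partial w=\varphi_k^{ -1}(w)$ if $k>0$ and $v$ begins with $a$, and $\partial w=\hat\varphi_k^{ -1}(w)$ if $k>0$ and $v$ begins with $b$ (inverse images of injective morphisms, well defined). -}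

module Defs where

open import Data.Nat using (ℕ; zero; suc; _+_; _<_; _≤_)
open import Data.List using (List; []; _∷_; _++_; reverse; take; drop; length; foldl; concatMap; replicate; [_])
open import Data.Maybe using (Maybe; just; nothing)
open import Data.Bool using (Bool; true; false; if_then_else_)
open import Data.Product using (_×_)
open import Relation.Nullary using (Dec; yes; no; does)
open import Relation.Binary.PropositionalEquality using (_≡_; refl)
import Data.List.Properties as LP

data Letter : Set where
  a b : Letter

Word : Set
Word = List Letter

_≟L_ : (x y : Letter) → Dec (x ≡ y)
a ≟L a = yes refl
a ≟L b = no λ ()
b ≟L a = no λ ()
b ≟L b = yes refl

_≟W_ : (u v : Word) → Dec (u ≡ v)
_≟W_ = LP.≡-dec _≟L_

other : Letter → Letter
other a = b
other b = a

isPal : Word → Bool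
isPal u = does (reverse u ≟W u)

-- z⁺ : the shortest palindrome having z as a prefix.
-- Any palindrome p with prefix z and |p| ≤ 2|z| has the form z ++ reverse (take i z)
-- (i = |p| - |z|), and z ++ reverse z is a palindrome; so z⁺ is the first
-- palindromic candidate z ++ reverse (take i z), i = 0, 1, ..., |z|.
palSearch : Word → ℕ → ℕ → Word
palSearch z i zero = z ++ reverse (take i z)
palSearch z i (suc fuel) =
  if isPal (z ++ reverse (take i z)) then z ++ reverse (take i z)
  else palSearch z (suc i) fuel

palClose : Word → Word
palClose z = palSearch z 0 (length z)

ψ : Word → Word
ψ = foldl (λ p x → palClose (p ++ [ x ])) []

count : Letter → Word → ℕ
count y [] = 0
count y (x ∷ u) = if does (x ≟L y) then suc (count y u) else count y u

at : Word → ℕ → Maybe Letter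
at [] i = nothing
at (x ∷ u) zero = just x
at (x ∷ u) (suc i) = at u i

HasPeriod : Word → ℕ → Set
HasPeriod u p = ∀ i → i + p < length u → at u i ≡ at u (i + p)

-- p is the minimal period π(u) (least p ≥ 1 which is a period; π(ε) = 1)
IsMinPeriod : Word → ℕ → Set
IsMinPeriod u p = (1 ≤ p) × HasPeriod u p × (∀ q → 1 ≤ q → HasPeriod u q → p ≤ q)

leadRun : Letter → Word → ℕ
leadRun x [] = 0
leadRun x (y ∷ ys) = if does (x ≟L y) then suc (leadRun x ys) else 0

index : Letter → Word → ℕ
index x v' = suc (leadRun x v')

φ : ℕ → Letter → Word
φ k a = replicate (suc k) a ++ [ b ]
φ k b = replicate k a ++ [ b ]

φ̂ : ℕ → Letter → Word
φ̂ k a = a ∷ replicate k b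
φ̂ k b = a ∷ replicate (suc k) b

applyMorph : (Letter → Word) → Word → Word
applyMorph f = concatMap f

christoffel : Word → Word
christoffel v = a ∷ (ψ v ++ [ b ])

-- IsDerivative v u : u = ∂(a ψ(v) b)
IsDerivative : Word → Word → Set
IsDerivative [] u = u ≡ [ a ]
IsDerivative (a ∷ v') u = applyMorph (φ (index a v')) u ≡ christoffel (a ∷ v')
IsDerivative (b ∷ v') u = applyMorph (φ̂ (index b v')) u ≡ christoffel (b ∷ v')

-- Justin's formula ψ(x t) = μₓ(ψ t) x, with μₓ : x ↦ x, y ↦ x y, gives a ψ(x t) b = γₓ(a ψ(t) b)
-- for γ_a : a ↦ a, b ↦ a b and γ_b : a ↦ a b, b ↦ b.  Composing γₓ with φ_k (resp. φ̂_k) gives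
-- φ_{k+1} (resp. φ̂_{k+1}), so ∂w exists, and it has exactly one letter per occurrence of y in w.
-- On the other side, ψ(s x) = ψ(s) R is a palindrome whose palindromic prefixes are the ψ(t),
-- t ⊑ s x; hence a period q < |R| would produce a palindromic prefix longer than ψ(s), and the
-- minimal period of ψ(s x) is |R| = |ψ(s x)| − |ψ(s)|.  With s x = ṽ, the equality
-- |ψ(ṽ)| = |ψ(v)| (the length of a ψ(v) b is 1ᵀ M_v 1 for a product M_v of the mutually transposed
-- matrices [[1,1],[0,1]] and [[1,0],[1,1]]) turns this into |ψ(x v')| − |ψ(v')|, which counts the
-- occurrences of y that γₓ inserts, i.e. |a ψ(v') b|_y = |a ψ(x v') b|_y.

module Submission where

open import Defs
open import Data.Nat using (ℕ; zero; suc; _+_; _*_; _∸_; _⊓_; _≤_; _<_; z≤n; s≤s)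
open import Data.Nat.Properties
open import Data.Nat.Tactic.RingSolver using (solve-∀)
open import Data.List using ([]; _∷_; _++_; reverse; take; drop; length; foldl; foldr; concatMap; replicate; [_])
open import Data.List.Properties
  using ( ∷-injective; ∷ʳ-injective; ++-assoc; ++-identityʳ; ++-cancelˡ; length-++; length-reverse
        ; length-take; length-drop; take-all; take++drop≡id; reverse-++; reverse-involutive
        ; unfold-reverse; foldl-++; reverse-foldr; concatMap-++; concatMap-cong )
open import Data.List.Membership.Propositional using (_∈_; _∉_)
open import Data.List.Membership.Propositional.Properties using (∈-insert)
open import Data.List.Relation.Unary.Any using (here; there)
open import Data.Maybe using (just)
open import Data.Bool using (true; false)
open import Function using (_∘_)
open import Data.Product using (Σ-syntax; ∃; ∃₂; _×_; _,_; swap; proj₂)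
open import Data.Sum using (_⊎_; inj₁; inj₂)
open import Data.Empty using (⊥; ⊥-elim)
open import Relation.Nullary using (yes; no)
open import Relation.Binary.PropositionalEquality hiding ([_])
open ≡-Reasoning

Palindrome : Word → Set
Palindrome w = reverse w ≡ w

infix 4 _⊑_
_⊑_ : Word → Word → Set
t ⊑ s = ∃ λ r → t ++ r ≡ s

isPal-complete : ∀ w → Palindrome w → isPal w ≡ true
isPal-complete w p with reverse w ≟W w
... | yes _ = refl
... | no ¬p = ⊥-elim (¬p p)

isPal-sound : ∀ w → isPal w ≡ true → Palindrome w
isPal-sound w e with reverse w ≟W w
... | yes p = p
isPal-sound w () | no _

length-∷ʳ : ∀ (xs : Word) x → length (xs ++ [ x ]) ≡ suc (length xs)
length-∷ʳ xs x = trans (length-++ xs) (+-comm (length xs) 1)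

take-length-++ : (xs ys : Word) → take (length xs) (xs ++ ys) ≡ xs
take-length-++ []       ys = refl
take-length-++ (x ∷ xs) ys = cong (x ∷_) (take-length-++ xs ys)

take-++-≤ : ∀ n (xs ys : Word) → n ≤ length xs → take n (xs ++ ys) ≡ take n xs
take-++-≤ zero    xs       ys _       = refl
take-++-≤ (suc n) (x ∷ xs) ys (s≤s h) = cong (x ∷_) (take-++-≤ n xs ys h)

++-split : ∀ (A B C D : Word) → A ++ B ≡ C ++ D → length C ≤ length A →
           ∃ λ E → A ≡ C ++ E × D ≡ E ++ B
++-split A       B []      D e _ = A , refl , sym e
++-split (_ ∷ A) B (c ∷ C) D e (s≤s h) with ∷-injective e
... | refl , e′ with ++-split A B C D e′ h
...   | E , e₁ , e₂ = E , cong (c ∷_) e₁ , e₂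

⊑-refl : ∀ s → s ⊑ s
⊑-refl s = [] , ++-identityʳ s

⊑-trans : ∀ {t u s} → t ⊑ u → u ⊑ s → t ⊑ s
⊑-trans {t} (r₁ , refl) (r₂ , refl) = r₁ ++ r₂ , sym (++-assoc t r₁ r₂)

⊑-++ : ∀ t r → t ⊑ t ++ r
⊑-++ t r = r , refl

⊑-length : ∀ {t s} → t ⊑ s → length t ≤ length s
⊑-length {t} (r , refl) = subst (length t ≤_) (sym (length-++ t)) (m≤m+n _ _)

⊑-by-length : ∀ {t u s} → t ⊑ s → u ⊑ s → length t ≤ length u → t ⊑ u
⊑-by-length {t} {u} (r , refl) (r′ , e) h with ++-split u r′ t r e h
... | E , e₁ , _ = E , sym e₁

⊑-antisym-length : ∀ {t s} → t ⊑ s → length s ≤ length t → t ≡ s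
⊑-antisym-length {t} ([]    , e)    _ = trans (sym (++-identityʳ t)) e
⊑-antisym-length {t} (x ∷ r , refl) h = ⊥-elim (m+1+n≰m (length t) (subst (_≤ length t) (length-++ t) h))

⊑-same-length : ∀ {t u s} → t ⊑ s → u ⊑ s → length t ≡ length u → t ≡ u
⊑-same-length p q e = ⊑-antisym-length (⊑-by-length p q (≤-reflexive e)) (≤-reflexive (sym e))

⊑-∷ʳ : ∀ {t} s x → t ⊑ s ++ [ x ] → t ⊑ s ⊎ t ≡ s ++ [ x ]
⊑-∷ʳ {t} s x p with length t ≤? length s
... | yes h = inj₁ (⊑-by-length p (⊑-++ s [ x ]) h)
... | no h  = inj₂ (⊑-antisym-length p (subst (_≤ length t) (sym (length-∷ʳ s x)) (≰⇒> h)))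

snoc-induction : (P : Word → Set) → P [] → (∀ s x → P s → P (s ++ [ x ])) → ∀ s → P s
snoc-induction P p[] p∷ʳ s = go s [] p[]
  where
  go : ∀ r s₀ → P s₀ → P (s₀ ++ r)
  go []      s₀ p = subst P (sym (++-identityʳ s₀)) p
  go (x ∷ r) s₀ p = subst P (++-assoc s₀ [ x ] r) (go r (s₀ ++ [ x ]) (p∷ʳ s₀ x p))

candidate : Word → ℕ → Word
candidate z i = z ++ reverse (take i z)

length-candidate : ∀ z i → length (candidate z i) ≡ length z + i ⊓ length z
length-candidate z i = begin
  length (z ++ reverse (take i z))        ≡⟨ length-++ z ⟩
  length z + length (reverse (take i z))  ≡⟨ cong (length z +_) (trans (length-reverse (take i z)) (length-take i z)) ⟩
  length z + i ⊓ length z                 ∎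

length-candidate-≤ : ∀ z i → length (candidate z i) ≤ length z + i
length-candidate-≤ z i = subst (_≤ length z + i) (sym (length-candidate z i)) (+-monoʳ-≤ (length z) (m⊓n≤m i (length z)))

palindrome-double : (z : Word) → Palindrome (z ++ reverse z)
palindrome-double z rewrite reverse-++ z (reverse z) | reverse-involutive z = refl

palSearch-candidate : ∀ z i f → ∃ λ j → palSearch z i f ≡ candidate z j
palSearch-candidate z i zero = i , refl
palSearch-candidate z i (suc f) with isPal (candidate z i)
... | true  = i , refl
... | false = palSearch-candidate z (suc i) f

-- The last candidate z ++ reverse z is always a palindrome, so the fuel suffices.
palSearch-palindrome : ∀ z i f → i + f ≡ length z → Palindrome (palSearch z i f)
palSearch-palindrome z i zero e
  rewrite +-identityʳ i | e | take-all (length z) z ≤-refl = palindrome-double z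
palSearch-palindrome z i (suc f) e with isPal (candidate z i) in eq
... | true  = isPal-sound _ eq
... | false = palSearch-palindrome z (suc i) f (trans (sym (+-suc i f)) e)

palSearch-minimal : ∀ z i f j → i ≤ j → Palindrome (candidate z j) →
                    length (palSearch z i f) ≤ length z + j
palSearch-minimal z i zero j i≤j _ = ≤-trans (length-candidate-≤ z i) (+-monoʳ-≤ (length z) i≤j)
palSearch-minimal z i (suc f) j i≤j p with isPal (candidate z i) in eq
... | true  = ≤-trans (length-candidate-≤ z i) (+-monoʳ-≤ (length z) i≤j)
... | false with m≤n⇒m<n∨m≡n i≤j
...   | inj₁ i<j  = palSearch-minimal z (suc i) f j i<j p
...   | inj₂ refl with trans (sym (isPal-complete _ p)) eq
...     | ()

palClose-palindrome : ∀ z → Palindrome (palClose z)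
palClose-palindrome z = palSearch-palindrome z 0 (length z) refl

palClose-extends : ∀ z → z ⊑ palClose z
palClose-extends z with palSearch-candidate z 0 (length z)
... | j , e = reverse (take j z) , sym e

palClose-length-≤ : ∀ z → length (palClose z) ≤ length z + length z
palClose-length-≤ z with palSearch-candidate z 0 (length z)
... | j , e = subst (_≤ length z + length z) (sym (trans (cong length e) (length-candidate z j)))
                (+-monoʳ-≤ (length z) (m⊓n≤n j (length z)))

palindrome-tail : (z R : Word) → Palindrome (z ++ R) → length R ≤ length z →
                  R ≡ reverse (take (length R) z)
palindrome-tail z R p h = trans (sym (reverse-involutive R)) (cong reverse reverse-R)
  where
  reverse-R : reverse R ≡ take (length R) z
  reverse-R = begin
    reverse R                                      ≡⟨ take-length-++ (reverse R) (reverse z) ⟨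
    take (length (reverse R)) (reverse R ++ reverse z) ≡⟨ cong₂ take (length-reverse R) (sym (reverse-++ z R)) ⟩
    take (length R) (reverse (z ++ R))              ≡⟨ cong (take (length R)) p ⟩
    take (length R) (z ++ R)                        ≡⟨ take-++-≤ (length R) z R h ⟩
    take (length R) z                               ∎

palClose-minimal : ∀ z Q → Palindrome Q → z ⊑ Q → length (palClose z) ≤ length Q
palClose-minimal z Q p (R , refl) with length z ≤? length R
... | yes h = ≤-trans (palClose-length-≤ z) (subst (_ ≤_) (sym (length-++ z)) (+-monoʳ-≤ (length z) h))
... | no h  = subst (length (palClose z) ≤_) (sym (length-++ z))
                (palSearch-minimal z 0 (length z) (length R) z≤n
                  (subst (λ w → Palindrome (z ++ w)) (palindrome-tail z R p R≤z) p))
  where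
  R≤z : length R ≤ length z
  R≤z = <⇒≤ (≰⇒> h)

palClose-unique : ∀ z Q → Palindrome Q → z ⊑ Q →
                  (∀ Q′ → Palindrome Q′ → z ⊑ Q′ → length Q ≤ length Q′) → palClose z ≡ Q
palClose-unique z Q pQ (R₂ , refl) minimal with palClose-extends z
... | R₁ , e = begin
  palClose z                        ≡⟨ e ⟨
  z ++ R₁                           ≡⟨ cong (z ++_) (palindrome-tail z R₁ p₁ R₁≤z) ⟩
  z ++ reverse (take (length R₁) z) ≡⟨ cong (λ n → z ++ reverse (take n z)) same-length ⟩
  z ++ reverse (take (length R₂) z) ≡⟨ cong (z ++_) (palindrome-tail z R₂ pQ (subst (_≤ length z) same-length R₁≤z)) ⟨
  z ++ R₂                           ∎
  where
  p₁ : Palindrome (z ++ R₁)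
  p₁ = subst Palindrome (sym e) (palClose-palindrome z)
  same-length : length R₁ ≡ length R₂
  same-length = +-cancelˡ-≡ (length z) _ _ (begin
    length z + length R₁ ≡⟨ length-++ z ⟨
    length (z ++ R₁)     ≡⟨ ≤-antisym (subst (λ w → length w ≤ _) (sym e) (palClose-minimal z (z ++ R₂) pQ (R₂ , refl)))
                                      (minimal (z ++ R₁) p₁ (R₁ , refl)) ⟩
    length (z ++ R₂)     ≡⟨ length-++ z ⟩
    length z + length R₂ ∎)
  R₁≤z : length R₁ ≤ length z
  R₁≤z = +-cancelˡ-≤ (length z) _ _
           (subst (_≤ length z + length z) (trans (cong length (sym e)) (length-++ z)) (palClose-length-≤ z))

ψ-∷ʳ : ∀ s x → ψ (s ++ [ x ]) ≡ palClose (ψ s ++ [ x ])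
ψ-∷ʳ s x = foldl-++ _ [] s [ x ]

ψ-∷ʳ-extends : ∀ s x → ψ s ++ [ x ] ⊑ ψ (s ++ [ x ])
ψ-∷ʳ-extends s x = subst (ψ s ++ [ x ] ⊑_) (sym (ψ-∷ʳ s x)) (palClose-extends _)

ψ-palindrome : ∀ s → Palindrome (ψ s)
ψ-palindrome = snoc-induction (Palindrome ∘ ψ) refl
  (λ s x _ → subst Palindrome (sym (ψ-∷ʳ s x)) (palClose-palindrome (ψ s ++ [ x ])))

ψ-mono : ∀ {t s} → t ⊑ s → ψ t ⊑ ψ s
ψ-mono {t} (r , refl) = go r t
  where
  go : ∀ r t → ψ t ⊑ ψ (t ++ r)
  go []      t = subst (λ w → ψ t ⊑ ψ w) (sym (++-identityʳ t)) (⊑-refl (ψ t))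
  go (x ∷ r) t = ⊑-trans (⊑-trans (⊑-++ (ψ t) [ x ]) (ψ-∷ʳ-extends t x))
                         (subst (λ w → ψ (t ++ [ x ]) ⊑ ψ w) (++-assoc t [ x ] r) (go r (t ++ [ x ])))

palindromic-prefix-of-ψ : ∀ s Q → Palindrome Q → Q ⊑ ψ s → ∃ λ t → t ⊑ s × Q ≡ ψ t
palindromic-prefix-of-ψ = snoc-induction _ base step
  where
  base : ∀ Q → Palindrome Q → Q ⊑ [] → ∃ λ t → t ⊑ [] × Q ≡ ψ t
  base [] _ _ = [] , ⊑-refl [] , refl
  base (_ ∷ _) _ (_ , ())
  step : ∀ s x → (∀ Q → Palindrome Q → Q ⊑ ψ s → ∃ λ t → t ⊑ s × Q ≡ ψ t) →
         ∀ Q → Palindrome Q → Q ⊑ ψ (s ++ [ x ]) → ∃ λ t → t ⊑ s ++ [ x ] × Q ≡ ψ t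
  step s x ih Q pQ Q⊑ with length Q ≤? length (ψ s)
  ... | yes h with ih Q pQ (⊑-by-length Q⊑ (ψ-mono (⊑-++ s [ x ])) h)
  ...   | t , t⊑s , e = t , ⊑-trans t⊑s (⊑-++ s [ x ]) , e
  step s x ih Q pQ Q⊑ | no h = s ++ [ x ] , ⊑-refl _ , ⊑-antisym-length Q⊑ ψsx≤Q
    where
    -- ψ s x ⊑ Q, and ψ (s x) is the shortest palindrome with that prefix
    ψsx≤Q : length (ψ (s ++ [ x ])) ≤ length Q
    ψsx≤Q = subst (λ w → length w ≤ length Q) (sym (ψ-∷ʳ s x))
      (palClose-minimal _ Q pQ (⊑-by-length (ψ-∷ʳ-extends s x) Q⊑
        (subst (_≤ length Q) (sym (length-∷ʳ (ψ s) x)) (≰⇒> h))))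

ψ-prefix-∷ʳ : ∀ T x s → Palindrome T → T ++ [ x ] ⊑ ψ s → ∃₂ λ t r → s ≡ t ++ x ∷ r × T ≡ ψ t
ψ-prefix-∷ʳ T x s pT Tx⊑ with palindromic-prefix-of-ψ s T pT (⊑-trans (⊑-++ T [ x ]) Tx⊑)
... | t , ([] , e) , refl = ⊥-elim (m+1+n≰m (length (ψ t)) {0} (subst₂ _≤_ (length-++ (ψ t)) (cong (length ∘ ψ) t≡s) (⊑-length Tx⊑)))
  where
  t≡s : s ≡ t
  t≡s = trans (sym e) (++-identityʳ t)
... | t , (y ∷ r , refl) , refl = t , r , cong (λ z → t ++ z ∷ r) (sym x≡y) , refl
  where
  ψty⊑ : ψ t ++ [ y ] ⊑ ψ (t ++ y ∷ r)
  ψty⊑ = ⊑-trans (ψ-∷ʳ-extends t y) (subst (λ w → ψ (t ++ [ y ]) ⊑ ψ w) (++-assoc t [ y ] r) (ψ-mono (⊑-++ (t ++ [ y ]) r)))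
  x≡y : x ≡ y
  x≡y = proj₂ (∷ʳ-injective (ψ t) (ψ t) (⊑-same-length Tx⊑ ψty⊑ (trans (length-∷ʳ (ψ t) x) (sym (length-∷ʳ (ψ t) y)))))

last-occurrence : ∀ x w → x ∉ w ⊎ ∃₂ λ w₁ w₂ → w ≡ w₁ ++ x ∷ w₂ × x ∉ w₂
last-occurrence x [] = inj₁ λ ()
last-occurrence x (y ∷ w) with last-occurrence x w
... | inj₂ (w₁ , w₂ , e , x∉w₂) = inj₂ (y ∷ w₁ , w₂ , cong (y ∷_) e , x∉w₂)
... | inj₁ x∉w with y ≟L x
...   | yes refl = inj₂ ([] , w , refl , x∉w)
...   | no y≢x   = inj₁ λ { (here x≡y) → y≢x (sym x≡y) ; (there x∈w) → x∉w x∈w }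

+-≡-≤-cancel : ∀ {m n y w} → m + y ≡ n + w → m ≤ n → w ≤ y
+-≡-≤-cancel {m} {n} {y} {w} e m≤n = +-cancelˡ-≤ n w y (subst (_≤ n + y) e (+-monoˡ-≤ y m≤n))

occurrence-before-last : ∀ {x} (s₁ s₂ t r : Word) → s₁ ++ x ∷ s₂ ≡ t ++ x ∷ r → length s₁ < length t → x ∉ s₂ → ⊥
occurrence-before-last []       s₂ (_ ∷ t) r e _       x∉s₂ = x∉s₂ (subst (_ ∈_) (sym (proj₂ (∷-injective e))) (∈-insert t))
occurrence-before-last (_ ∷ s₁) s₂ (_ ∷ t) r e (s≤s h) x∉s₂ = occurrence-before-last s₁ s₂ t r (proj₂ (∷-injective e)) h x∉s₂

-- In a palindrome ψ s x Y, the block Ỹ x is a prefix and what follows it is a palindrome E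
-- with E x ⊑ ψ s, so E is ψ t for an occurrence t x of x in s.
ψ-palindromic-continuation : ∀ s x Y → Palindrome (ψ s ++ x ∷ Y) → suc (length Y) ≤ length (ψ s) →
  ∃₂ λ t r → s ≡ t ++ x ∷ r × length (ψ t) + suc (length Y) ≡ length (ψ s)
ψ-palindromic-continuation s x Y p h with ++-split S (x ∷ Y) Ỹx S S-x-Y h′
  where
  S = ψ s
  Ỹx = reverse Y ++ [ x ]
  h′ : length Ỹx ≤ length S
  h′ = subst (_≤ length S) (sym (trans (length-∷ʳ (reverse Y) x) (cong suc (length-reverse Y)))) h
  S-x-Y : S ++ x ∷ Y ≡ Ỹx ++ S
  S-x-Y = sym (begin
    Ỹx ++ S                          ≡⟨ cong (_++ S) (unfold-reverse x Y) ⟨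
    reverse (x ∷ Y) ++ S             ≡⟨ cong (reverse (x ∷ Y) ++_) (ψ-palindrome s) ⟨
    reverse (x ∷ Y) ++ reverse S     ≡⟨ reverse-++ S (x ∷ Y) ⟨
    reverse (S ++ x ∷ Y)             ≡⟨ p ⟩
    S ++ x ∷ Y                       ∎)
... | E , S≡ỸxE , S≡ExY with ψ-prefix-∷ʳ E x s palindrome-E (Y , trans (++-assoc E [ x ] Y) (sym S≡ExY))
  where
  S = ψ s
  Ỹx = reverse Y ++ [ x ]
  palindrome-E : Palindrome E
  palindrome-E = ++-cancelˡ Ỹx (reverse E) E (begin
    Ỹx ++ reverse E                 ≡⟨ cong (_++ reverse E) (unfold-reverse x Y) ⟨
    reverse (x ∷ Y) ++ reverse E    ≡⟨ reverse-++ E (x ∷ Y) ⟨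
    reverse (E ++ x ∷ Y)            ≡⟨ cong reverse S≡ExY ⟨
    reverse S                       ≡⟨ ψ-palindrome s ⟩
    S                               ≡⟨ S≡ỸxE ⟩
    Ỹx ++ E                         ∎)
...   | t , r , s≡ , refl = t , r , s≡ , sym (trans (cong length S≡ExY) (length-++ (ψ t)))

palClose-∷ʳ : ∀ S x W → Palindrome (S ++ x ∷ W) →
              (∀ Y → Palindrome (S ++ x ∷ Y) → length W ≤ length Y) →
              palClose (S ++ [ x ]) ≡ S ++ x ∷ W
palClose-∷ʳ S x W p shortest = palClose-unique (S ++ [ x ]) (S ++ x ∷ W) p (W , ++-assoc S [ x ] W) minimal
  where
  minimal : ∀ Q → Palindrome Q → S ++ [ x ] ⊑ Q → length (S ++ x ∷ W) ≤ length Q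
  minimal Q pQ (Y , refl) = subst₂ _≤_ (sym (length-++ S)) (trans (sym (length-++ S)) (cong length (sym (++-assoc S [ x ] Y))))
    (+-monoʳ-≤ (length S) (s≤s (shortest Y (subst Palindrome (++-assoc S [ x ] Y) pQ))))

ψ-∷ʳ-fresh : ∀ s x → x ∉ s → ψ (s ++ [ x ]) ≡ ψ s ++ x ∷ ψ s
ψ-∷ʳ-fresh s x x∉s = trans (ψ-∷ʳ s x) (palClose-∷ʳ S x S palindrome shortest)
  where
  S = ψ s
  palindrome : Palindrome (S ++ x ∷ S)
  palindrome = begin
    reverse (S ++ x ∷ S)             ≡⟨ reverse-++ S (x ∷ S) ⟩
    reverse (x ∷ S) ++ reverse S     ≡⟨ cong (_++ reverse S) (unfold-reverse x S) ⟩
    (reverse S ++ [ x ]) ++ reverse S ≡⟨ cong (λ z → (z ++ [ x ]) ++ z) (ψ-palindrome s) ⟩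
    (S ++ [ x ]) ++ S                ≡⟨ ++-assoc S [ x ] S ⟩
    S ++ x ∷ S                       ∎
  shortest : ∀ Y → Palindrome (S ++ x ∷ Y) → length S ≤ length Y
  shortest Y p with suc (length Y) ≤? length S
  ... | no h  = ≤-pred (≰⇒> h)
  ... | yes h with ψ-palindromic-continuation s x Y p h
  ...   | t , r , refl , _ = ⊥-elim (x∉s (∈-insert t))

ψ-occurrence : ∀ s₁ x s₂ → ∃ λ W → ψ (s₁ ++ x ∷ s₂) ≡ ψ s₁ ++ x ∷ W
ψ-occurrence s₁ x s₂ with ⊑-trans (ψ-∷ʳ-extends s₁ x) (subst (λ w → ψ (s₁ ++ [ x ]) ⊑ ψ w) (++-assoc s₁ [ x ] s₂) (ψ-mono (⊑-++ (s₁ ++ [ x ]) s₂)))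
... | W , e = W , trans (sym e) (++-assoc (ψ s₁) [ x ] W)

ψ-∷ʳ-recurrent : ∀ s₁ x s₂ → x ∉ s₂ → let s = s₁ ++ x ∷ s₂ in
  ∃ λ W → ψ s ≡ ψ s₁ ++ x ∷ W × ψ (s ++ [ x ]) ≡ ψ s ++ x ∷ W
ψ-∷ʳ-recurrent s₁ x s₂ x∉s₂ with ψ-occurrence s₁ x s₂
... | W , eS = W , eS , trans (ψ-∷ʳ s x) (palClose-∷ʳ S x W palindrome shortest)
  where
  s = s₁ ++ x ∷ s₂
  S = ψ s
  S₁ = ψ s₁
  palindrome : Palindrome (S ++ x ∷ W)
  palindrome = begin
    reverse (S ++ x ∷ W)                    ≡⟨ reverse-++ S (x ∷ W) ⟩
    reverse (x ∷ W) ++ reverse S            ≡⟨ cong (reverse (x ∷ W) ++_) (trans (ψ-palindrome s) eS) ⟩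
    reverse (x ∷ W) ++ (S₁ ++ x ∷ W)        ≡⟨ ++-assoc (reverse (x ∷ W)) S₁ (x ∷ W) ⟨
    (reverse (x ∷ W) ++ S₁) ++ x ∷ W        ≡⟨ cong (λ z → (reverse (x ∷ W) ++ z) ++ x ∷ W) (ψ-palindrome s₁) ⟨
    (reverse (x ∷ W) ++ reverse S₁) ++ x ∷ W ≡⟨ cong (_++ x ∷ W) (reverse-++ S₁ (x ∷ W)) ⟨
    reverse (S₁ ++ x ∷ W) ++ x ∷ W          ≡⟨ cong (λ z → reverse z ++ x ∷ W) eS ⟨
    reverse S ++ x ∷ W                      ≡⟨ cong (_++ x ∷ W) (ψ-palindrome s) ⟩
    S ++ x ∷ W                              ∎
  |S| : length S ≡ length S₁ + suc (length W)
  |S| = trans (cong length eS) (length-++ S₁)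
  shortest : ∀ Y → Palindrome (S ++ x ∷ Y) → length W ≤ length Y
  shortest Y p with suc (length Y) ≤? length S
  ... | no h = ≤-trans (m+n≤o⇒n≤o (suc (length S₁)) (≤-reflexive (trans (sym (+-suc (length S₁) (length W))) (sym |S|))))
                       (≤-pred (≰⇒> h))
  ... | yes h with ψ-palindromic-continuation s x Y p h
  ...   | t , r , s≡ , |ψt|+ with length t ≤? length s₁
  ...     | no t>s₁ = ⊥-elim (occurrence-before-last s₁ s₂ t r s≡ (≰⇒> t>s₁) x∉s₂)
  ...     | yes t≤s₁ = ≤-pred (+-≡-≤-cancel (trans |ψt|+ |S|) ψt≤S₁)
    where
    ψt≤S₁ : length (ψ t) ≤ length S₁
    ψt≤S₁ = ⊑-length (ψ-mono (⊑-by-length (x ∷ r , sym s≡) (x ∷ s₂ , refl) t≤s₁))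

μ₁ : Letter → Letter → Word
μ₁ a a = a ∷ []
μ₁ a b = a ∷ b ∷ []
μ₁ b a = b ∷ a ∷ []
μ₁ b b = b ∷ []

μ : Letter → Word → Word
μ x = concatMap (μ₁ x)

μ-++ : ∀ x A B → μ x (A ++ B) ≡ μ x A ++ μ x B
μ-++ x = concatMap-++ (μ₁ x)

μ₁-same : ∀ x → μ₁ x x ≡ [ x ]
μ₁-same a = refl
μ₁-same b = refl

μ₁-other : ∀ {x y} → x ≢ y → μ₁ x y ≡ x ∷ y ∷ []
μ₁-other {a} {a} x≢y = ⊥-elim (x≢y refl)
μ₁-other {a} {b} _   = refl
μ₁-other {b} {a} _   = refl
μ₁-other {b} {b} x≢y = ⊥-elim (x≢y refl)

μ-around : ∀ x y S → μ x (S ++ y ∷ S) ++ [ x ] ≡ μ x S ++ μ₁ x y ++ μ x S ++ [ x ]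
μ-around x y S = begin
  μ x (S ++ y ∷ S) ++ [ x ]              ≡⟨ cong (_++ [ x ]) (μ-++ x S (y ∷ S)) ⟩
  (μ x S ++ μ₁ x y ++ μ x S) ++ [ x ]    ≡⟨ ++-assoc (μ x S) (μ₁ x y ++ μ x S) [ x ] ⟩
  μ x S ++ (μ₁ x y ++ μ x S) ++ [ x ]    ≡⟨ cong (μ x S ++_) (++-assoc (μ₁ x y) (μ x S) [ x ]) ⟩
  μ x S ++ μ₁ x y ++ μ x S ++ [ x ]      ∎

Justin : Letter → Word → Set
Justin x t = ψ (x ∷ t) ≡ μ x (ψ t) ++ [ x ]

justin-[] : ∀ x → Justin x []
justin-[] a = refl
justin-[] b = refl

justin-∷ʳ-recurrent : ∀ x w₁ y w₂ → y ∉ w₂ → let w = w₁ ++ y ∷ w₂ in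
  Justin x w → Justin x w₁ → Justin x (w ++ [ y ])
justin-∷ʳ-recurrent x w₁ y w₂ y∉w₂ ih ih₁
  with ψ-∷ʳ-recurrent (x ∷ w₁) y w₂ y∉w₂ | ψ-∷ʳ-recurrent w₁ y w₂ y∉w₂
... | W , ψxw≡ , ψxwy≡ | V , ψw≡ , ψwy≡ = begin
  ψ ((x ∷ w) ++ [ y ])                  ≡⟨ ψxwy≡ ⟩
  ψ (x ∷ w) ++ y ∷ W                    ≡⟨ cong (_++ y ∷ W) ih ⟩
  (M ++ [ x ]) ++ y ∷ W                 ≡⟨ ++-assoc M [ x ] (y ∷ W) ⟩
  M ++ x ∷ y ∷ W                        ≡⟨ cong (M ++_) tails ⟨
  M ++ μ x (y ∷ V) ++ [ x ]             ≡⟨ ++-assoc M (μ x (y ∷ V)) [ x ] ⟨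
  (M ++ μ x (y ∷ V)) ++ [ x ]           ≡⟨ cong (_++ [ x ]) (μ-++ x (ψ w) (y ∷ V)) ⟨
  μ x (ψ w ++ y ∷ V) ++ [ x ]           ≡⟨ cong (λ z → μ x z ++ [ x ]) ψwy≡ ⟨
  μ x (ψ (w ++ [ y ])) ++ [ x ]         ∎
  where
  w = w₁ ++ y ∷ w₂
  M = μ x (ψ w)
  M₁ = μ x (ψ w₁)
  -- ψ(x w) written in two ways, both starting with M₁ = μ x (ψ w₁)
  tails : μ x (y ∷ V) ++ [ x ] ≡ x ∷ y ∷ W
  tails = ++-cancelˡ M₁ _ _ (begin
    M₁ ++ μ x (y ∷ V) ++ [ x ]      ≡⟨ ++-assoc M₁ (μ x (y ∷ V)) [ x ] ⟨
    (M₁ ++ μ x (y ∷ V)) ++ [ x ]    ≡⟨ cong (_++ [ x ]) (μ-++ x (ψ w₁) (y ∷ V)) ⟨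
    μ x (ψ w₁ ++ y ∷ V) ++ [ x ]    ≡⟨ cong (λ z → μ x z ++ [ x ]) ψw≡ ⟨
    μ x (ψ w) ++ [ x ]              ≡⟨ ih ⟨
    ψ (x ∷ w)                       ≡⟨ ψxw≡ ⟩
    ψ (x ∷ w₁) ++ y ∷ W             ≡⟨ cong (_++ y ∷ W) ih₁ ⟩
    (M₁ ++ [ x ]) ++ y ∷ W          ≡⟨ ++-assoc M₁ [ x ] (y ∷ W) ⟩
    M₁ ++ x ∷ y ∷ W                 ∎)

justin-∷ʳ-first : ∀ x w → x ∉ w → Justin x w → Justin x (w ++ [ x ])
justin-∷ʳ-first x w x∉w ih with ψ-∷ʳ-recurrent [] x w x∉w
... | W , ψxw≡ , ψxwx≡ = begin
  ψ ((x ∷ w) ++ [ x ])                  ≡⟨ ψxwx≡ ⟩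
  ψ (x ∷ w) ++ x ∷ W                    ≡⟨ cong (ψ (x ∷ w) ++_) ψxw≡ ⟨
  ψ (x ∷ w) ++ ψ (x ∷ w)                ≡⟨ cong (λ z → z ++ z) ih ⟩
  (M ++ [ x ]) ++ M ++ [ x ]            ≡⟨ ++-assoc M [ x ] (M ++ [ x ]) ⟩
  M ++ x ∷ M ++ [ x ]                   ≡⟨ cong (λ m → M ++ m ++ M ++ [ x ]) (μ₁-same x) ⟨
  M ++ μ₁ x x ++ M ++ [ x ]             ≡⟨ μ-around x x (ψ w) ⟨
  μ x (ψ w ++ x ∷ ψ w) ++ [ x ]         ≡⟨ cong (λ z → μ x z ++ [ x ]) (ψ-∷ʳ-fresh w x x∉w) ⟨
  μ x (ψ (w ++ [ x ])) ++ [ x ]         ∎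
  where
  M = μ x (ψ w)

justin-∷ʳ-fresh : ∀ x w y → x ≢ y → y ∉ w → Justin x w → Justin x (w ++ [ y ])
justin-∷ʳ-fresh x w y x≢y y∉w ih = begin
  ψ ((x ∷ w) ++ [ y ])                  ≡⟨ ψ-∷ʳ-fresh (x ∷ w) y y∉xw ⟩
  ψ (x ∷ w) ++ y ∷ ψ (x ∷ w)            ≡⟨ cong (λ z → z ++ y ∷ z) ih ⟩
  (M ++ [ x ]) ++ y ∷ M ++ [ x ]        ≡⟨ ++-assoc M [ x ] (y ∷ M ++ [ x ]) ⟩
  M ++ x ∷ y ∷ M ++ [ x ]               ≡⟨ cong (λ m → M ++ m ++ M ++ [ x ]) (μ₁-other x≢y) ⟨
  M ++ μ₁ x y ++ M ++ [ x ]             ≡⟨ μ-around x y (ψ w) ⟨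
  μ x (ψ w ++ y ∷ ψ w) ++ [ x ]         ≡⟨ cong (λ z → μ x z ++ [ x ]) (ψ-∷ʳ-fresh w y y∉w) ⟨
  μ x (ψ (w ++ [ y ])) ++ [ x ]         ∎
  where
  M = μ x (ψ w)
  y∉xw : y ∉ x ∷ w
  y∉xw (here y≡x)  = x≢y (sym y≡x)
  y∉xw (there y∈w) = y∉w y∈w

justin : ∀ x t → Justin x t
justin x t = snoc-induction (λ w → ∀ t → t ⊑ w → Justin x t) base step t t (⊑-refl t)
  where
  base : ∀ t → t ⊑ [] → Justin x t
  base []      _       = justin-[] x
  base (_ ∷ _) (_ , ())
  step : ∀ w y → (∀ t → t ⊑ w → Justin x t) → ∀ t → t ⊑ w ++ [ y ] → Justin x t
  step w y ih t t⊑ with ⊑-∷ʳ w y t⊑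
  ... | inj₁ t⊑w = ih t t⊑w
  ... | inj₂ refl with last-occurrence y w
  ...   | inj₂ (w₁ , w₂ , refl , y∉w₂) =
          justin-∷ʳ-recurrent x w₁ y w₂ y∉w₂ (ih _ (⊑-refl _)) (ih w₁ (y ∷ w₂ , refl))
  ...   | inj₁ y∉w with x ≟L y
  ...     | yes refl = justin-∷ʳ-first x w y∉w (ih w (⊑-refl w))
  ...     | no x≢y   = justin-∷ʳ-fresh x w y x≢y y∉w (ih w (⊑-refl w))

γ : Letter → Letter → Word
γ a y   = μ₁ a y
γ b a   = a ∷ b ∷ []
γ b b   = b ∷ []

γ-b-shift : ∀ W → b ∷ concatMap (γ b) W ≡ μ b W ++ [ b ]
γ-b-shift []      = refl
γ-b-shift (a ∷ W) = cong (λ z → b ∷ a ∷ z) (γ-b-shift W)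
γ-b-shift (b ∷ W) = cong (b ∷_) (γ-b-shift W)

christoffel-∷ : ∀ x w → christoffel (x ∷ w) ≡ concatMap (γ x) (christoffel w)
christoffel-∷ a w = cong (a ∷_) (begin
  ψ (a ∷ w) ++ [ b ]              ≡⟨ cong (_++ [ b ]) (justin a w) ⟩
  (μ a (ψ w) ++ [ a ]) ++ [ b ]   ≡⟨ ++-assoc (μ a (ψ w)) [ a ] [ b ] ⟩
  μ a (ψ w) ++ a ∷ b ∷ []         ≡⟨ concatMap-++ (μ₁ a) (ψ w) [ b ] ⟨
  concatMap (γ a) (ψ w ++ [ b ])  ∎)
christoffel-∷ b w = cong (a ∷_) (begin
  ψ (b ∷ w) ++ [ b ]                   ≡⟨ cong (_++ [ b ]) (justin b w) ⟩
  (μ b (ψ w) ++ [ b ]) ++ [ b ]        ≡⟨ cong (_++ [ b ]) (γ-b-shift (ψ w)) ⟨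
  b ∷ concatMap (γ b) (ψ w) ++ [ b ]   ≡⟨ cong (b ∷_) (concatMap-++ (γ b) (ψ w) [ b ]) ⟨
  b ∷ concatMap (γ b) (ψ w ++ [ b ])   ∎)

concatMap-∘ : ∀ (f g : Letter → Word) xs →
              concatMap f (concatMap g xs) ≡ concatMap (λ y → concatMap f (g y)) xs
concatMap-∘ f g []       = refl
concatMap-∘ f g (x ∷ xs) = trans (concatMap-++ f (g x) (concatMap g xs)) (cong (concatMap f (g x) ++_) (concatMap-∘ f g xs))

γ-a-aⁿb : ∀ n → concatMap (γ a) (replicate n a ++ [ b ]) ≡ a ∷ replicate n a ++ [ b ]
γ-a-aⁿb zero    = refl
γ-a-aⁿb (suc n) = cong (a ∷_) (γ-a-aⁿb n)

γ-b-bⁿ : ∀ n → concatMap (γ b) (replicate n b) ≡ replicate n b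
γ-b-bⁿ zero    = refl
γ-b-bⁿ (suc n) = cong (b ∷_) (γ-b-bⁿ n)

γ-a∘φ : ∀ k y → concatMap (γ a) (φ k y) ≡ φ (suc k) y
γ-a∘φ k a = γ-a-aⁿb (suc k)
γ-a∘φ k b = γ-a-aⁿb k

γ-b∘φ̂ : ∀ k y → concatMap (γ b) (φ̂ k y) ≡ φ̂ (suc k) y
γ-b∘φ̂ k a = cong (λ z → a ∷ b ∷ z) (γ-b-bⁿ k)
γ-b∘φ̂ k b = cong (λ z → a ∷ b ∷ z) (γ-b-bⁿ (suc k))

γ-a∘γ-b : ∀ y → concatMap (γ a) (γ b y) ≡ φ 1 y
γ-a∘γ-b a = refl
γ-a∘γ-b b = refl

γ-b∘γ-a : ∀ y → concatMap (γ b) (γ a y) ≡ φ̂ 1 y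
γ-b∘γ-a a = refl
γ-b∘γ-a b = refl

derivative-step : ∀ x (f g : Letter → Word) u w → (∀ y → concatMap (γ x) (f y) ≡ g y) →
                  concatMap f u ≡ christoffel w → concatMap g u ≡ christoffel (x ∷ w)
derivative-step x f g u w γf≡g e = begin
  concatMap g u                              ≡⟨ concatMap-cong γf≡g u ⟨
  concatMap (λ y → concatMap (γ x) (f y)) u  ≡⟨ concatMap-∘ (γ x) f u ⟨
  concatMap (γ x) (concatMap f u)            ≡⟨ cong (concatMap (γ x)) e ⟩
  concatMap (γ x) (christoffel w)            ≡⟨ christoffel-∷ x w ⟨
  christoffel (x ∷ w)                        ∎

derivative-a : ∀ v′ → ∃ (IsDerivative (a ∷ v′))
derivative-a []      = [ a ] , refl
derivative-a (a ∷ v) with derivative-a v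
... | u , e = u , derivative-step a _ _ u (a ∷ v) (γ-a∘φ (index a v)) e
derivative-a (b ∷ v) = christoffel v , derivative-step a (γ b) (φ 1) (christoffel v) (b ∷ v) γ-a∘γ-b (sym (christoffel-∷ b v))

derivative-b : ∀ v′ → ∃ (IsDerivative (b ∷ v′))
derivative-b []      = [ b ] , refl
derivative-b (b ∷ v) with derivative-b v
... | u , e = u , derivative-step b _ _ u (b ∷ v) (γ-b∘φ̂ (index b v)) e
derivative-b (a ∷ v) = christoffel v , derivative-step b (γ a) (φ̂ 1) (christoffel v) (a ∷ v) γ-b∘γ-a (sym (christoffel-∷ a v))

derivative : ∀ x v′ → ∃ (IsDerivative (x ∷ v′))
derivative a = derivative-a
derivative b = derivative-b

count-b-aⁿb : ∀ n R → count b ((replicate n a ++ [ b ]) ++ R) ≡ suc (count b R)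
count-b-aⁿb zero    R = refl
count-b-aⁿb (suc n) R = count-b-aⁿb n R

count-a-bⁿ : ∀ n R → count a (replicate n b ++ R) ≡ count a R
count-a-bⁿ zero    R = refl
count-a-bⁿ (suc n) R = count-a-bⁿ n R

count-b-φ : ∀ k u → count b (concatMap (φ k) u) ≡ length u
count-b-φ k []      = refl
count-b-φ k (a ∷ u) = trans (count-b-aⁿb (suc k) _) (cong suc (count-b-φ k u))
count-b-φ k (b ∷ u) = trans (count-b-aⁿb k _) (cong suc (count-b-φ k u))

count-a-φ̂ : ∀ k u → count a (concatMap (φ̂ k) u) ≡ length u
count-a-φ̂ k []      = refl
count-a-φ̂ k (a ∷ u) = cong suc (trans (count-a-bⁿ k _) (count-a-φ̂ k u))
count-a-φ̂ k (b ∷ u) = cong suc (trans (count-a-bⁿ (suc k) _) (count-a-φ̂ k u))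

derivative-length : ∀ x v′ u → IsDerivative (x ∷ v′) u → length u ≡ count (other x) (christoffel (x ∷ v′))
derivative-length a v′ u e = trans (sym (count-b-φ (index a v′) u)) (cong (count b) e)
derivative-length b v′ u e = trans (sym (count-a-φ̂ (index b v′) u)) (cong (count a) e)

length-count : ∀ W → length W ≡ count a W + count b W
length-count []      = refl
length-count (a ∷ W) = cong suc (length-count W)
length-count (b ∷ W) = trans (cong suc (length-count W)) (sym (+-suc (count a W) (count b W)))

count-a-γ-a : ∀ W → count a (concatMap (γ a) W) ≡ count a W + count b W
count-a-γ-a []      = refl
count-a-γ-a (a ∷ W) = cong suc (count-a-γ-a W)
count-a-γ-a (b ∷ W) = trans (cong suc (count-a-γ-a W)) (sym (+-suc (count a W) (count b W)))

count-b-γ-a : ∀ W → count b (concatMap (γ a) W) ≡ count b W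
count-b-γ-a []      = refl
count-b-γ-a (a ∷ W) = count-b-γ-a W
count-b-γ-a (b ∷ W) = cong suc (count-b-γ-a W)

count-a-γ-b : ∀ W → count a (concatMap (γ b) W) ≡ count a W
count-a-γ-b []      = refl
count-a-γ-b (a ∷ W) = cong suc (count-a-γ-b W)
count-a-γ-b (b ∷ W) = count-a-γ-b W

count-b-γ-b : ∀ W → count b (concatMap (γ b) W) ≡ count a W + count b W
count-b-γ-b []      = refl
count-b-γ-b (a ∷ W) = cong suc (count-b-γ-b W)
count-b-γ-b (b ∷ W) = trans (cong suc (count-b-γ-b W)) (sym (+-suc (count a W) (count b W)))

count-other-γ : ∀ x W → count (other x) (concatMap (γ x) W) ≡ count (other x) W
count-other-γ a = count-b-γ-a
count-other-γ b = count-a-γ-b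

length-γ : ∀ x W → length (concatMap (γ x) W) ≡ length W + count (other x) W
length-γ a W = begin
  length (concatMap (γ a) W)                                 ≡⟨ length-count (concatMap (γ a) W) ⟩
  count a (concatMap (γ a) W) + count b (concatMap (γ a) W)  ≡⟨ cong₂ _+_ (count-a-γ-a W) (count-b-γ-a W) ⟩
  (count a W + count b W) + count b W                        ≡⟨ cong (_+ count b W) (length-count W) ⟨
  length W + count b W                                       ∎
length-γ b W = begin
  length (concatMap (γ b) W)                                 ≡⟨ length-count (concatMap (γ b) W) ⟩
  count a (concatMap (γ b) W) + count b (concatMap (γ b) W)  ≡⟨ cong₂ _+_ (count-a-γ-b W) (count-b-γ-b W) ⟩
  count a W + (count a W + count b W)                        ≡⟨ +-comm (count a W) _ ⟩
  (count a W + count b W) + count a W                        ≡⟨ cong (_+ count a W) (length-count W) ⟨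
  length W + count a W                                       ∎

length-christoffel : ∀ w → length (christoffel w) ≡ suc (suc (length (ψ w)))
length-christoffel w = cong suc (length-∷ʳ (ψ w) b)

length-ψ-∷ : ∀ x v → length (ψ (x ∷ v)) ≡ length (ψ v) + count (other x) (christoffel v)
length-ψ-∷ x v = suc-injective (suc-injective (begin
  suc (suc (length (ψ (x ∷ v))))                     ≡⟨ length-christoffel (x ∷ v) ⟨
  length (christoffel (x ∷ v))                       ≡⟨ cong length (christoffel-∷ x v) ⟩
  length (concatMap (γ x) (christoffel v))           ≡⟨ length-γ x (christoffel v) ⟩
  length (christoffel v) + count (other x) (christoffel v) ≡⟨ cong (_+ count (other x) (christoffel v)) (length-christoffel v) ⟩
  suc (suc (length (ψ v))) + count (other x) (christoffel v) ∎))

act : Letter → ℕ × ℕ → ℕ × ℕ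
act a (p , q) = p + q , q
act b (p , q) = p , p + q

parikh : Word → ℕ × ℕ
parikh W = count a W , count b W

total : ℕ × ℕ → ℕ
total (p , q) = p + q

dot : ℕ × ℕ → ℕ × ℕ → ℕ
dot (p , q) (r , s) = p * r + q * s

parikh-γ : ∀ x W → parikh (concatMap (γ x) W) ≡ act x (parikh W)
parikh-γ a W = cong₂ _,_ (count-a-γ-a W) (count-b-γ-a W)
parikh-γ b W = cong₂ _,_ (count-a-γ-b W) (count-b-γ-b W)

parikh-christoffel : ∀ w → parikh (christoffel w) ≡ foldr act (1 , 1) w
parikh-christoffel []      = refl
parikh-christoffel (x ∷ w) = begin
  parikh (christoffel (x ∷ w))              ≡⟨ cong parikh (christoffel-∷ x w) ⟩
  parikh (concatMap (γ x) (christoffel w))  ≡⟨ parikh-γ x (christoffel w) ⟩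
  act x (parikh (christoffel w))            ≡⟨ cong (act x) (parikh-christoffel w) ⟩
  act x (foldr act (1 , 1) w)               ∎

-- act a and act b are mutually transposed matrices.
act-adjoint : ∀ y u v → dot u (act y v) ≡ dot (act (other y) u) v
act-adjoint a (p , q) (r , s) = identity p q r s
  where
  identity : ∀ p q r s → p * (r + s) + q * s ≡ p * r + (p + q) * s
  identity = solve-∀
act-adjoint b (p , q) (r , s) = identity p q r s
  where
  identity : ∀ p q r s → p * r + q * (r + s) ≡ (p + q) * r + q * s
  identity = solve-∀

actᵀ : ℕ × ℕ → Letter → ℕ × ℕ
actᵀ u y = act (other y) u

foldr-act-adjoint : ∀ w u v → dot u (foldr act v w) ≡ dot (foldl actᵀ u w) v
foldr-act-adjoint []      u v = refl
foldr-act-adjoint (y ∷ w) u v = trans (act-adjoint y u (foldr act v w)) (foldr-act-adjoint w (actᵀ u y) v)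

swap-foldl-act : ∀ w u → foldl actᵀ (swap u) w ≡ swap (foldl (λ u y → act y u) u w)
swap-foldl-act []      u = refl
swap-foldl-act (y ∷ w) u = trans (cong (λ z → foldl actᵀ z w) (swap-act y u)) (swap-foldl-act w (act y u))
  where
  swap-act : ∀ y u → actᵀ (swap u) y ≡ swap (act y u)
  swap-act a (p , q) = cong (q ,_) (+-comm q p)
  swap-act b (p , q) = cong (_, p) (+-comm q p)

total-dotʳ : ∀ u → dot u (1 , 1) ≡ total u
total-dotʳ (p , q) = cong₂ _+_ (*-identityʳ p) (*-identityʳ q)

total-dotˡ : ∀ u → dot (1 , 1) u ≡ total u
total-dotˡ (p , q) = cong₂ _+_ (*-identityˡ p) (*-identityˡ q)

total-swap : ∀ u → total (swap u) ≡ total u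
total-swap (p , q) = +-comm q p

-- Transposing a product of act-matrices reverses it and exchanges the letters; swapping
-- the coordinates exchanges them back, and total is the bilinear form of the all-ones vector.
total-foldr-act-reverse : ∀ w → total (foldr act (1 , 1) (reverse w)) ≡ total (foldr act (1 , 1) w)
total-foldr-act-reverse w = begin
  total (foldr act (1 , 1) (reverse w))          ≡⟨ cong total (reverse-foldr act (1 , 1) w) ⟩
  total (foldl (λ u y → act y u) (1 , 1) w)      ≡⟨ total-swap (foldl (λ u y → act y u) (1 , 1) w) ⟨
  total (swap (foldl (λ u y → act y u) (1 , 1) w)) ≡⟨ cong total (swap-foldl-act w (1 , 1)) ⟨
  total (foldl actᵀ (1 , 1) w)                   ≡⟨ total-dotʳ (foldl actᵀ (1 , 1) w) ⟨
  dot (foldl actᵀ (1 , 1) w) (1 , 1)             ≡⟨ foldr-act-adjoint w (1 , 1) (1 , 1) ⟨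
  dot (1 , 1) (foldr act (1 , 1) w)              ≡⟨ total-dotˡ (foldr act (1 , 1) w) ⟩
  total (foldr act (1 , 1) w)                    ∎

length-christoffel-parikh : ∀ w → length (christoffel w) ≡ total (foldr act (1 , 1) w)
length-christoffel-parikh w = trans (length-count (christoffel w)) (cong total (parikh-christoffel w))

length-ψ-reverse : ∀ w → length (ψ (reverse w)) ≡ length (ψ w)
length-ψ-reverse w = suc-injective (suc-injective (begin
  suc (suc (length (ψ (reverse w))))          ≡⟨ length-christoffel (reverse w) ⟨
  length (christoffel (reverse w))            ≡⟨ length-christoffel-parikh (reverse w) ⟩
  total (foldr act (1 , 1) (reverse w))       ≡⟨ total-foldr-act-reverse w ⟩
  total (foldr act (1 , 1) w)                 ≡⟨ length-christoffel-parikh w ⟨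
  length (christoffel w)                      ≡⟨ length-christoffel w ⟩
  suc (suc (length (ψ w)))                    ∎))

at-++ˡ : ∀ (xs ys : Word) i → i < length xs → at (xs ++ ys) i ≡ at xs i
at-++ˡ (x ∷ xs) ys zero    _       = refl
at-++ˡ (x ∷ xs) ys (suc i) (s≤s h) = at-++ˡ xs ys i h

at-++ʳ : ∀ (xs ys : Word) i → at (xs ++ ys) (length xs + i) ≡ at ys i
at-++ʳ []       ys i = refl
at-++ʳ (x ∷ xs) ys i = at-++ʳ xs ys i

at-take : ∀ n (xs : Word) i → i < n → at (take n xs) i ≡ at xs i
at-take (suc n) []       i       _       = refl
at-take (suc n) (x ∷ xs) zero    _       = refl
at-take (suc n) (x ∷ xs) (suc i) (s≤s h) = at-take n xs i h

at-drop : ∀ n (xs : Word) i → at (drop n xs) i ≡ at xs (n + i)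
at-drop zero    xs       i = refl
at-drop (suc n) []       i = refl
at-drop (suc n) (x ∷ xs) i = at-drop n xs i

≡-by-at : ∀ (xs ys : Word) → length xs ≡ length ys → (∀ i → i < length xs → at xs i ≡ at ys i) → xs ≡ ys
≡-by-at []       []       _ _ = refl
≡-by-at (x ∷ xs) (y ∷ ys) l h =
  cong₂ _∷_ (just-injective (h 0 (s≤s z≤n))) (≡-by-at xs ys (suc-injective l) (λ i i< → h (suc i) (s≤s i<)))
  where
  just-injective : ∀ {x y : Letter} → just x ≡ just y → x ≡ y
  just-injective refl = refl

-- S R = R̃ S̃ = R̃ S, so shifting by |R| maps S R into itself.
palindromic-extension-period : ∀ S R → Palindrome (S ++ R) → Palindrome S → HasPeriod (S ++ R) (length R)
palindromic-extension-period S R pSR pS i i+R< = begin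
  at (S ++ R) i                                 ≡⟨ at-++ˡ S R i i<S ⟩
  at S i                                        ≡⟨ at-++ʳ (reverse R) S i ⟨
  at (reverse R ++ S) (length (reverse R) + i)  ≡⟨ cong (at (reverse R ++ S)) (trans (cong (_+ i) (length-reverse R)) (+-comm (length R) i)) ⟩
  at (reverse R ++ S) (i + length R)            ≡⟨ cong (λ z → at z (i + length R)) SR≡R̃S ⟨
  at (S ++ R) (i + length R)                    ∎
  where
  SR≡R̃S : S ++ R ≡ reverse R ++ S
  SR≡R̃S = sym (trans (cong (reverse R ++_) (sym pS)) (trans (sym (reverse-++ S R)) pSR))
  i<S : i < length S
  i<S = +-cancelʳ-≤ (length R) (suc i) (length S) (subst (suc (i + length R) ≤_) (length-++ S) i+R<)

-- The prefix of length |P| − q equals the suffix of that length, which is its mirror image.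
border-palindrome : ∀ P q → Palindrome P → HasPeriod P q → q ≤ length P → Palindrome (take (length P ∸ q) P)
border-palindrome P q pP per q≤P = trans (cong reverse B≡D) D̃≡B
  where
  k = length P ∸ q
  B = take k P
  D = drop q P
  |B| : length B ≡ k
  |B| = trans (length-take k P) (m≤n⇒m⊓n≡m (m∸n≤m (length P) q))
  B≡D : B ≡ D
  B≡D = ≡-by-at B D (trans |B| (sym (length-drop q P))) λ i i<B → let i<k = subst (i <_) |B| i<B in begin
    at B i        ≡⟨ at-take k P i i<k ⟩
    at P i        ≡⟨ per i (subst (i + q <_) (m∸n+n≡m q≤P) (+-monoˡ-< q i<k)) ⟩
    at P (i + q)  ≡⟨ cong (at P) (+-comm i q) ⟩
    at P (q + i)  ≡⟨ at-drop q P i ⟨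
    at D i        ∎
  D̃≡B : reverse D ≡ B
  D̃≡B = begin
    reverse D                                        ≡⟨ take-length-++ (reverse D) (reverse (take q P)) ⟨
    take (length (reverse D)) (reverse D ++ reverse (take q P)) ≡⟨ cong₂ take (trans (length-reverse D) (length-drop q P)) (sym (reverse-++ (take q P) D)) ⟩
    take k (reverse (take q P ++ D))                 ≡⟨ cong (λ z → take k (reverse z)) (take++drop≡id q P) ⟩
    take k (reverse P)                               ≡⟨ cong (take k) pP ⟩
    B                                                ∎

-- A shorter period q would give the palindromic prefix ψ t of length |ψ(s x)| − q with t ⊑ s.
ψ-∷ʳ-minimal-period : ∀ s x R → ψ s ++ x ∷ R ≡ ψ (s ++ [ x ]) → IsMinPeriod (ψ (s ++ [ x ])) (suc (length R))
ψ-∷ʳ-minimal-period s x R e = s≤s z≤n , period , minimal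
  where
  P = ψ (s ++ [ x ])
  |P| : length P ≡ length (ψ s) + suc (length R)
  |P| = trans (cong length (sym e)) (length-++ (ψ s))
  period : HasPeriod P (suc (length R))
  period = subst (λ P → HasPeriod P (length (x ∷ R))) e
    (palindromic-extension-period (ψ s) (x ∷ R) (subst Palindrome (sym e) (ψ-palindrome (s ++ [ x ]))) (ψ-palindrome s))
  minimal : ∀ q → 1 ≤ q → HasPeriod P q → suc (length R) ≤ q
  minimal q 1≤q per with length P ≤? q
  ... | yes P≤q = ≤-trans (m+n≤o⇒n≤o (length (ψ s)) (≤-reflexive (sym |P|))) P≤q
  ... | no P≰q  = short-period (≰⇒> P≰q)
    where
    k = length P ∸ q
    B = take k P
    |B| : length B ≡ k
    |B| = trans (length-take k P) (m≤n⇒m⊓n≡m (m∸n≤m (length P) q))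
    short-period : q < length P → suc (length R) ≤ q
    short-period q<P with palindromic-prefix-of-ψ (s ++ [ x ]) B
                            (border-palindrome P q (ψ-palindrome (s ++ [ x ])) per (<⇒≤ q<P))
                            (drop k P , take++drop≡id k P)
    ... | t , t⊑sx , B≡ψt with ⊑-∷ʳ s x t⊑sx
    ...   | inj₂ refl = ⊥-elim (<-irrefl (trans (sym |B|) (cong length B≡ψt)) (∸-monoʳ-< {o = 0} 1≤q (<⇒≤ q<P)))
    ...   | inj₁ t⊑s  = +-cancelˡ-≤ (length (ψ s)) (suc (length R)) q
                          (subst₂ _≤_ |P| (+-comm q (length (ψ s))) (≤-trans (m≤n+m∸n (length P) q) (+-monoʳ-≤ q k≤ψs)))
      where
      k≤ψs : k ≤ length (ψ s)
      k≤ψs = subst (_≤ length (ψ s)) (trans (cong length (sym B≡ψt)) |B|) (⊑-length (ψ-mono t⊑s))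

ψ-reverse-minimal-period : ∀ x v′ → IsMinPeriod (ψ (reverse (x ∷ v′))) (count (other x) (christoffel (x ∷ v′)))
ψ-reverse-minimal-period x v′ with ψ-∷ʳ-extends (reverse v′) x
... | R , e = subst₂ IsMinPeriod (cong ψ (sym (unfold-reverse x v′))) period-length
                (ψ-∷ʳ-minimal-period (reverse v′) x R (trans (sym (++-assoc (ψ (reverse v′)) [ x ] R)) e))
  where
  c = count (other x) (christoffel v′)
  period-length : suc (length R) ≡ count (other x) (christoffel (x ∷ v′))
  period-length = +-cancelˡ-≡ (length (ψ v′)) _ _ (begin
    length (ψ v′) + suc (length R)           ≡⟨ cong (_+ suc (length R)) (length-ψ-reverse v′) ⟨
    length (ψ (reverse v′)) + suc (length R) ≡⟨ length-++ (ψ (reverse v′)) ⟨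
    length (ψ (reverse v′) ++ x ∷ R)         ≡⟨ cong length (trans (sym (++-assoc (ψ (reverse v′)) [ x ] R)) e) ⟩
    length (ψ (reverse v′ ++ [ x ]))         ≡⟨ cong (length ∘ ψ) (unfold-reverse x v′) ⟨
    length (ψ (reverse (x ∷ v′)))            ≡⟨ length-ψ-reverse (x ∷ v′) ⟩
    length (ψ (x ∷ v′))                      ≡⟨ length-ψ-∷ x v′ ⟩
    length (ψ v′) + c                        ≡⟨ cong (length (ψ v′) +_) (count-other-γ x (christoffel v′)) ⟨
    length (ψ v′) + count (other x) (concatMap (γ x) (christoffel v′)) ≡⟨ cong (λ w → length (ψ v′) + count (other x) w) (christoffel-∷ x v′) ⟨
    length (ψ v′) + count (other x) (christoffel (x ∷ v′)) ∎)

mainTheorem6 : (x : Letter) (v' : Word) →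
    Σ[ u ∈ Word ] (IsDerivative (x ∷ v') u
      × IsMinPeriod (ψ (reverse (x ∷ v'))) (length u)
      × length u ≡ count (other x) (christoffel (x ∷ v')))
mainTheorem6 x v' with derivative x v'
... | u , ∂ = u , ∂ , subst (IsMinPeriod (ψ (reverse (x ∷ v')))) (sym |u|) (ψ-reverse-minimal-period x v') , |u|
  where
  |u| : length u ≡ count (other x) (christoffel (x ∷ v'))
  |u| = derivative-length x v' u ∂
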